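{- Let $k\ge2$ and $0<\varepsilon<2/(3k)$. Let $T$ be an $\ell$-splittable tree in which every leaf is a district. Then for every leaf $v$ of $T$, every viable edge of $v$ is an edge of the branch $\mathcal{B}_v$, i.e., $\mathcal{V}_v\subseteq E(\mathcal{B}_v)$.
   Context: $T$ is a tree with nonnegative vertex weights $w(v)$ summing to $1$; the weight of a subtree $T'$ is $w(T')=\sum_{v\in V(T')}w(v)$. A subtree is a district if its weight lies in $[1/k-\varepsilon/2,\,1/k+\varepsilon/2]$ (a leaf $v$ is a district if the single-vertex subtree $\{v\}$ is). A tree is $\ell$-splittable if it contains $\ell-1$ edges whose removal yields a forest in which every tree is a district. $\deg(T)$ is the maximum degree of $T$. For a leaf $v$: if $\deg(T)\ge3$, the branch $\mathcal{B}_v$ is the path from $v$ to the nearest vertex $u$ with $\deg(u)\ge3$; if $\deg(T)<3$, $\mathcal{B}_v=T$. An edge $e$ of $T$ is a viable edge of $v$ if deleting $e$ yields two subtrees $T_v\ni v$ and $T'$ where $T_v$ is a district and $T'$ is $(\ell-1)$-splittable; $\mathcal{V}_v$ is the set of viable edges of $v$.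
   Formalization: The vertex weights w(v) and the parameter ε take rational values rather than real ones. -}

module Defs where

open import Data.Nat using (ℕ; zero; suc; _≤_; _∸_; NonZero)
open import Data.Integer using (+_)
open import Data.Rational using (ℚ; 0ℚ; 1ℚ; ½; _+_; _-_; _*_; _/_) renaming (_≤_ to _≤ℚ_)
open import Data.Fin using (Fin; zero; suc; _≟_)
open import Data.Fin.Subset using (Subset; _∈_)
open import Data.Vec using (lookup)
open import Data.Bool using (if_then_else_)
open import Data.List using (List; []; _∷_; _++_; length; filter)
open import Data.List.Relation.Unary.All using (All)
open import Data.List.Relation.Unary.Unique.Propositional using (Unique)
open import Data.List.Relation.Binary.Permutation.Propositional using (_↭_)
import Data.List.Membership.Propositional as LM
open import Data.Product using (Σ; _×_; _,_; proj₁; proj₂; ∃)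
open import Data.Sum using (_⊎_)
open import Data.Unit using (⊤)
open import Relation.Nullary using (¬_)
open import Relation.Nullary.Decidable using (_⊎-dec_)
open import Relation.Binary.PropositionalEquality using (_≡_)
open import Relation.Binary.Construct.Closure.ReflexiveTransitive using (Star)
open import Function.Bundles using (_⇔_)

-- Graphs on vertex set Fin n, given by a list of edges (unordered: orientation irrelevant).
Edge : ℕ → Set
Edge n = Fin n × Fin n

Adj : ∀ {n} → List (Edge n) → Fin n → Fin n → Set
Adj es x y = ((x , y) LM.∈ es) ⊎ ((y , x) LM.∈ es)

Conn : ∀ {n} → List (Edge n) → Fin n → Fin n → Set
Conn es = Star (Adj es)

IsTree : ∀ {n} → List (Edge n) → Set
IsTree {n} es = (∀ u v → Conn es u v) × (suc (length es) ≡ n)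

deg : ∀ {n} → List (Edge n) → Fin n → ℕ
deg es v = length (filter (λ e → (proj₁ e ≟ v) ⊎-dec (proj₂ e ≟ v)) es)

IsLeaf : ∀ {n} → List (Edge n) → Fin n → Set
IsLeaf es v = deg es v ≡ 1

sumFin : ∀ {n} → (Fin n → ℚ) → ℚ
sumFin {zero} f = 0ℚ
sumFin {suc n} f = f zero + sumFin (λ i → f (suc i))

weight : ∀ {n} → (Fin n → ℚ) → Subset n → ℚ
weight w C = sumFin (λ i → if lookup C i then w i else 0ℚ)

District : (k : ℕ) → .{{NonZero k}} → ℚ → ℚ → Set
District k ε x = ((+ 1 / k) - ε * ½ ≤ℚ x) × (x ≤ℚ (+ 1 / k) + ε * ½)

IsComponent : ∀ {n} → List (Edge n) → Fin n → Subset n → Set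
IsComponent K x C = ∀ u → (u ∈ C) ⇔ Conn K x u

-- The tree with vertex set {u | V u} and edge list es (all edges inside V) is ℓ-splittable:
-- the edges split into removed edges R (ℓ-1 of them) and kept edges K,
-- and every tree of the resulting forest (component of a vertex of V under K) is a district.
Splittable : (k : ℕ) → .{{NonZero k}} → ℚ → ∀ {n} → (Fin n → ℚ) → ℕ →
             (Fin n → Set) → List (Edge n) → Set
Splittable k ε {n} w ℓ V es =
  Σ (List (Edge n)) λ R → Σ (List (Edge n)) λ K →
    (es ↭ R ++ K) × (suc (length R) ≡ ℓ) ×
    (∀ x → V x → ∀ (C : Subset n) → IsComponent K x C → District k ε (weight w C))

-- e is a viable edge of v in the tree (Fin n, es): deleting e gives T_v ∋ v (a district)
-- and T' (vertex set: vertices not connected to v, edge list E'), which is (ℓ-1)-splittable.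
Viable : (k : ℕ) → .{{NonZero k}} → ℚ → ∀ {n} → (Fin n → ℚ) → ℕ →
         List (Edge n) → Fin n → Edge n → Set
Viable k ε {n} w ℓ es v e =
  Σ (List (Edge n)) λ rest → (es ↭ e ∷ rest) ×
  Σ (List (Edge n)) λ Ev → Σ (List (Edge n)) λ E' →
    (rest ↭ Ev ++ E') ×
    All (λ f → Conn rest v (proj₁ f) × Conn rest v (proj₂ f)) Ev ×
    All (λ f → ¬ Conn rest v (proj₁ f) × ¬ Conn rest v (proj₂ f)) E' ×
    (∀ (C : Subset n) → IsComponent rest v C → District k ε (weight w C)) ×
    Splittable k ε w (ℓ ∸ 1) (λ u → ¬ Conn rest v u) E'

data Walk {n} (es : List (Edge n)) : Fin n → Fin n → Set where
  []  : ∀ {x} → Walk es x x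
  _∷_ : ∀ {x y z} → Adj es x y → Walk es y z → Walk es x z

verts : ∀ {n} {es : List (Edge n)} {x y} → Walk es x y → List (Fin n)
verts ([] {x}) = x ∷ []
verts (_∷_ {x} _ p) = x ∷ verts p

len : ∀ {n} {es : List (Edge n)} {x y} → Walk es x y → ℕ
len [] = 0
len (_ ∷ p) = suc (len p)

OnWalk : ∀ {n} {es : List (Edge n)} {x y} → Edge n → Walk es x y → Set
OnWalk e [] = Data.Empty.⊥ where import Data.Empty
OnWalk e (_∷_ {x} {y} _ p) = (e ≡ (x , y)) ⊎ (e ≡ (y , x)) ⊎ OnWalk e p

IsPath : ∀ {n} {es : List (Edge n)} {x y} → Walk es x y → Set
IsPath p = Unique (verts p)

NearestHighPath : ∀ {n} (es : List (Edge n)) (v u : Fin n) → Walk es v u → Set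
NearestHighPath {n} es v u p =
  IsPath p × (3 ≤ deg es u) ×
  (∀ (u' : Fin n) (q : Walk es v u') → IsPath q → 3 ≤ deg es u' → len p ≤ len q)

MaxDegAtLeast3 : ∀ {n} → List (Edge n) → Set
MaxDegAtLeast3 {n} es = ∃ λ (u : Fin n) → 3 ≤ deg es u

InBranch : ∀ {n} → List (Edge n) → Fin n → Edge n → Set
InBranch {n} es v e =
  ((¬ MaxDegAtLeast3 es) × e LM.∈ es)
  ⊎ (MaxDegAtLeast3 es × (∀ (u : Fin n) (p : Walk es v u) → NearestHighPath es v u p → OnWalk e p))

{-# OPTIONS --safe #-}

-- Suppose a viable edge e of the leaf v missed a walk from v to a vertex u of degree ≥ 3.
-- Then u lies in the district Tᵥ that e cuts off.  Tᵥ holds no leaf of T besides v, since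
-- two leaves alone weigh at least 2/k - ε > 1/k + ε/2 when ε < 2/(3k).  So every vertex of
-- Tᵥ except v has degree ≥ 2 and u has degree ≥ 3, and the degrees over Tᵥ add up to at
-- least 2|Tᵥ|.  But this sum counts e once and each of the at most |Tᵥ| - 1 edges inside
-- Tᵥ twice.  Without a vertex of degree ≥ 3 the branch is all of T.

module Submission where

open import Defs

module Graphs where

  open import Level using (Level; 0ℓ)
  open import Data.Bool.Base using (if_then_else_)
  open import Data.Nat.Base using (ℕ; zero; suc; _+_; _*_; _≤_; _<_; z≤n; s≤s)
  open import Data.Nat.Properties as ℕ
    using (≤-refl; ≤-trans; ≤-reflexive; +-identityʳ; +-suc; *-identityˡ; *-suc
          ; *-distribʳ-+; +-mono-≤; +-monoˡ-≤; +-monoʳ-≤; *-monoʳ-≤; +-cancelˡ-≤; +-cancelʳ-≤; n≤1+n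
          ; m≤m+n; m≤n+m; m≤m*n; n≤0⇒n≡0; 1+n≰n; ≤∧≢⇒<; +-*-semiring)
  open import Algebra.Properties.Semiring.Sum +-*-semiring
    using (sum; sum-syntax; ∑-distrib-+; *-distribˡ-sum; *-distribʳ-sum; sum-cong-≗; sum-replicate-zero)
  open import Data.Fin.Base using (Fin; zero; suc) renaming (_<_ to _<ᶠ_)
  open import Data.Fin.Properties using (_≟_; any?; all?; <-cmp; _<?_) renaming (<-trans to <ᶠ-trans; <-irrefl to <ᶠ-irrefl)
  open import Data.List.Base using (List; []; _∷_; _++_; length; filter; tabulate; map; allFin)
  open import Data.List.Properties using (length-++; length-map; filter-++; filter-some)
  open import Data.List.Relation.Unary.Any using (here; there)
  open import Data.List.Relation.Unary.All using (All; []; _∷_)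
  import Data.List.Relation.Unary.All as All
  open import Data.List.Membership.Propositional using (_∈_; lose)
  open import Data.List.Membership.Propositional.Properties
    using (∈-map⁺; ∈-filter⁺; ∈-allFin; ∈-++⁺ˡ; ∈-++⁺ʳ; ∈-++⁻)
  open import Data.List.Relation.Binary.Subset.Propositional using () renaming (_⊆_ to _⊆ˡ_)
  open import Data.List.Relation.Binary.Permutation.Propositional using (_↭_; ↭-sym; ↭-trans; ↭-prep)
  open import Data.List.Relation.Binary.Permutation.Propositional.Properties using (∈-resp-↭; ↭-length; filter-↭)
  open import Data.Empty using (⊥; ⊥-elim)
  open import Data.Product using (∃; _×_; _,_; proj₁; proj₂)
  import Data.Product as Product
  open import Data.Sum using (_⊎_; inj₁; inj₂)
  import Data.Sum as Sum
  open import Function.Base using (_∘_; id)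
  open import Relation.Binary.Construct.Closure.ReflexiveTransitive as Star using (ε; _◅_; _◅◅_; _⋆)
  open import Relation.Binary.PropositionalEquality
    using (_≡_; _≢_; refl; sym; trans; cong; cong₂; subst; module ≡-Reasoning)
  open import Relation.Nullary using (¬_; Dec; yes; no; does; contradiction)
  open import Relation.Nullary.Decidable using (_⊎-dec_; _×-dec_; _→-dec_; ¬?; map′; decidable-stable)
  open import Relation.Unary using (Pred; Decidable; _⊆_)
  open import Relation.Binary using (tri<; tri≈; tri>)

  private
    variable
      a b p q : Level
      A : Set a
      B : Set b
      n : ℕ

  𝟙 : Dec A → ℕ
  𝟙 a? = if does a? then 1 else 0

  𝟙≤1 : (a? : Dec A) → 𝟙 a? ≤ 1
  𝟙≤1 (yes _) = ≤-refl
  𝟙≤1 (no _)  = z≤n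

  𝟙-mono : (A → B) → (a? : Dec A) (b? : Dec B) → 𝟙 a? ≤ 𝟙 b?
  𝟙-mono A→B (yes a) (yes _) = ≤-refl
  𝟙-mono A→B (yes a) (no ¬b) = contradiction (A→B a) ¬b
  𝟙-mono A→B (no _)  _       = z≤n

  𝟙-no : (a? : Dec A) → ¬ A → 𝟙 a? ≡ 0
  𝟙-no (yes a) ¬a = contradiction a ¬a
  𝟙-no (no _)  _  = refl

  𝟙+𝟙≤1 : ¬ (A × B) → (a? : Dec A) (b? : Dec B) → 𝟙 a? + 𝟙 b? ≤ 1
  𝟙+𝟙≤1 ¬ab (yes a) (yes b) = contradiction (a , b) ¬ab
  𝟙+𝟙≤1 _   (yes _) (no _)  = ≤-refl
  𝟙+𝟙≤1 _   (no _)  b?      = 𝟙≤1 b?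

  length-filter-∷ : {P : Pred A p} (P? : Decidable P) (x : A) (xs : List A) →
                    length (filter P? (x ∷ xs)) ≡ 𝟙 (P? x) + length (filter P? xs)
  length-filter-∷ P? x xs with P? x
  ... | yes _ = refl
  ... | no _  = refl

  length-filter-tabulate : {P : Pred A p} (P? : Decidable P) (f : Fin n → A) →
                           length (filter P? (tabulate f)) ≡ ∑[ i < n ] 𝟙 (P? (f i))
  length-filter-tabulate {n = zero}  P? f = refl
  length-filter-tabulate {n = suc n} P? f =
    trans (length-filter-∷ P? (f zero) _) (cong (𝟙 (P? (f zero)) +_) (length-filter-tabulate P? (f ∘ suc)))

  ∑-mono-≤ : {f g : Fin n → ℕ} → (∀ i → f i ≤ g i) → sum f ≤ sum g
  ∑-mono-≤ {n = zero}  f≤g = z≤n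
  ∑-mono-≤ {n = suc n} f≤g = +-mono-≤ (f≤g zero) (∑-mono-≤ (f≤g ∘ suc))

  ∑-𝟙-≟ : (a : Fin n) → ∑[ x < n ] 𝟙 (a ≟ x) ≡ 1
  ∑-𝟙-≟ {n = suc n} zero    = cong suc (sum-replicate-zero n)
  ∑-𝟙-≟ {n = suc n} (suc a) = ∑-𝟙-≟ a

  ∑-δ : (a : Fin n) (c : ℕ) → ∑[ x < n ] (𝟙 (a ≟ x) * c) ≡ c
  ∑-δ {n} a c = begin
    ∑[ x < n ] (𝟙 (a ≟ x) * c) ≡⟨ *-distribʳ-sum c (λ x → 𝟙 (a ≟ x)) ⟨
    (∑[ x < n ] 𝟙 (a ≟ x)) * c ≡⟨ cong (_* c) (∑-𝟙-≟ a) ⟩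
    1 * c                      ≡⟨ *-identityˡ c ⟩
    c                          ∎
    where open ≡-Reasoning

  count : {P : Pred (Fin n) p} → Decidable P → ℕ
  count {n} P? = ∑[ x < n ] 𝟙 (P? x)

  count-all : {P : Pred (Fin n) p} (P? : Decidable P) → (∀ x → P x) → count P? ≡ n
  count-all {n = zero}  P? all = refl
  count-all {n = suc n} P? all with P? zero
  ... | yes _   = cong suc (count-all (P? ∘ suc) (all ∘ suc))
  ... | no ¬P₀ = contradiction (all zero) ¬P₀

  count-mono : {P : Pred (Fin n) p} {Q : Pred (Fin n) q} (P? : Decidable P) (Q? : Decidable Q) →
               P ⊆ Q → count P? ≤ count Q?
  count-mono P? Q? P⊆Q = ∑-mono-≤ (λ x → 𝟙-mono P⊆Q (P? x) (Q? x))

  count-≤-1 : {P : Pred (Fin n) p} (P? : Decidable P) (a : Fin n) → (∀ {x} → P x → a ≡ x) → count P? ≤ 1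
  count-≤-1 P? a only-a = ≤-trans (count-mono P? (a ≟_) only-a) (≤-reflexive (∑-𝟙-≟ a))

  count-≤-suc : {P : Pred (Fin n) p} {Q : Pred (Fin n) q} (P? : Decidable P) (Q? : Decidable Q) →
                (∀ {x y} → P x → ¬ Q x → P y → ¬ Q y → x ≡ y) → count P? ≤ suc (count Q?)
  count-≤-suc {n} {P = P} {Q} P? Q? unique with any? (λ x → P? x ×-dec ¬? (Q? x))
  ... | no none = ≤-trans (count-mono P? Q? P⊆Q) (n≤1+n _)
    where
    P⊆Q : P ⊆ Q
    P⊆Q {x} Px = decidable-stable (Q? x) (λ ¬Qx → none (x , Px , ¬Qx))
  ... | yes (a , Pa , ¬Qa) = begin
    count P?                            ≤⟨ ∑-mono-≤ bound ⟩
    ∑[ x < n ] (𝟙 (a ≟ x) + 𝟙 (Q? x)) ≡⟨ ∑-distrib-+ (𝟙 ∘ (a ≟_)) (𝟙 ∘ Q?) ⟩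
    ∑[ x < n ] 𝟙 (a ≟ x) + count Q?    ≡⟨ cong (_+ count Q?) (∑-𝟙-≟ a) ⟩
    suc (count Q?)                      ∎
    where
    open ℕ.≤-Reasoning
    bound : ∀ x → 𝟙 (P? x) ≤ 𝟙 (a ≟ x) + 𝟙 (Q? x)
    bound x with P? x | Q? x | a ≟ x
    ... | no _   | _      | _      = z≤n
    ... | yes _  | yes _  | _      = m≤n+m 1 _
    ... | yes _  | no _   | yes _  = ≤-refl
    ... | yes Px | no ¬Qx | no a≢x = contradiction (unique Pa ¬Qa Px ¬Qx) a≢x

  Adj-sym : {F : List (Edge n)} {x y : Fin n} → Adj F x y → Adj F y x
  Adj-sym (inj₁ xy∈F) = inj₂ xy∈F
  Adj-sym (inj₂ yx∈F) = inj₁ yx∈F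

  Conn-sym : {F : List (Edge n)} {x y : Fin n} → Conn F x y → Conn F y x
  Conn-sym = Star.reverse Adj-sym

  Adj-⊆ : {F G : List (Edge n)} {x y : Fin n} → F ⊆ˡ G → Adj F x y → Adj G x y
  Adj-⊆ F⊆G = Sum.map F⊆G F⊆G

  Conn-⊆ : {F G : List (Edge n)} {x y : Fin n} → F ⊆ˡ G → Conn F x y → Conn G x y
  Conn-⊆ F⊆G = Star.map (Adj-⊆ F⊆G)

  Adj-↭ : {F G : List (Edge n)} {x y : Fin n} → F ↭ G → Adj F x y → Adj G x y
  Adj-↭ F↭G = Adj-⊆ (∈-resp-↭ F↭G)

  Adj-∷⁻ : {F : List (Edge n)} {f : Edge n} {x y : Fin n} →
           Adj (f ∷ F) x y → f ≡ (x , y) ⊎ f ≡ (y , x) ⊎ Adj F x y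
  Adj-∷⁻ (inj₁ (here xy≡f))   = inj₁ (sym xy≡f)
  Adj-∷⁻ (inj₂ (here yx≡f))   = inj₂ (inj₁ (sym yx≡f))
  Adj-∷⁻ (inj₁ (there xy∈F)) = inj₂ (inj₂ (inj₁ xy∈F))
  Adj-∷⁻ (inj₂ (there yx∈F)) = inj₂ (inj₂ (inj₂ yx∈F))

  Conn-[] : {x y : Fin n} → Conn [] x y → x ≡ y
  Conn-[] ε                = refl
  Conn-[] (inj₁ () ◅ _)
  Conn-[] (inj₂ () ◅ _)

  ConnVia : List (Edge n) → Edge n → Fin n → Fin n → Set
  ConnVia F (a , b) x y = Conn F x y ⊎ (Conn F x a × Conn F b y) ⊎ (Conn F x b × Conn F a y)

  ConnVia-◅ : {F : List (Edge n)} {f : Edge n} {x y z : Fin n} →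
              Adj F x y → ConnVia F f y z → ConnVia F f x z
  ConnVia-◅ step = Sum.map (step ◅_) (Sum.map (Product.map₁ (step ◅_)) (Product.map₁ (step ◅_)))

  Conn-∷⁻ : {F : List (Edge n)} {a b x y : Fin n} → Conn ((a , b) ∷ F) x y → ConnVia F (a , b) x y
  Conn-∷⁻ ε = inj₁ ε
  Conn-∷⁻ (step ◅ path) with Adj-∷⁻ step | Conn-∷⁻ path
  ... | inj₁ refl        | inj₁ b~z              = inj₂ (inj₁ (ε , b~z))
  ... | inj₁ refl        | inj₂ (inj₁ (_ , b~z)) = inj₂ (inj₁ (ε , b~z))
  ... | inj₁ refl        | inj₂ (inj₂ (_ , a~z)) = inj₁ a~z
  ... | inj₂ (inj₁ refl) | inj₁ a~z              = inj₂ (inj₂ (ε , a~z))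
  ... | inj₂ (inj₁ refl) | inj₂ (inj₁ (_ , b~z)) = inj₁ b~z
  ... | inj₂ (inj₁ refl) | inj₂ (inj₂ (_ , a~z)) = inj₂ (inj₂ (ε , a~z))
  ... | inj₂ (inj₂ step′) | via                  = ConnVia-◅ step′ via

  Conn-∷⁺ : {F : List (Edge n)} {a b x y : Fin n} → ConnVia F (a , b) x y → Conn ((a , b) ∷ F) x y
  Conn-∷⁺ (inj₁ x~y)                 = Conn-⊆ there x~y
  Conn-∷⁺ (inj₂ (inj₁ (x~a , b~y))) = Conn-⊆ there x~a ◅◅ inj₁ (here refl) ◅ Conn-⊆ there b~y
  Conn-∷⁺ (inj₂ (inj₂ (x~b , a~y))) = Conn-⊆ there x~b ◅◅ inj₂ (here refl) ◅ Conn-⊆ there a~y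

  Conn? : (F : List (Edge n)) (x y : Fin n) → Dec (Conn F x y)
  Conn? []             x y = map′ (λ { refl → ε }) Conn-[] (x ≟ y)
  Conn? ((a , b) ∷ F) x y = map′ Conn-∷⁺ Conn-∷⁻
    (Conn? F x y ⊎-dec (Conn? F x a ×-dec Conn? F b y) ⊎-dec (Conn? F x b ×-dec Conn? F a y))

  incident? : (x : Fin n) → Decidable (λ (f : Edge n) → proj₁ f ≡ x ⊎ proj₂ f ≡ x)
  incident? x f = (proj₁ f ≟ x) ⊎-dec (proj₂ f ≟ x)

  Adj⇒0<deg : {F : List (Edge n)} {x y : Fin n} → Adj F x y → 0 < deg F y
  Adj⇒0<deg {y = y} (inj₁ xy∈F) = filter-some (incident? y) (lose xy∈F (inj₂ refl))
  Adj⇒0<deg {y = y} (inj₂ yx∈F) = filter-some (incident? y) (lose yx∈F (inj₁ refl))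

  Conn⇒0<deg : {F : List (Edge n)} {x y : Fin n} → Conn F x y → x ≢ y → 0 < deg F y
  Conn⇒0<deg ε x≢x = contradiction refl x≢x
  Conn⇒0<deg {y = y} (_◅_ {j = z} step path) _ with z ≟ y
  ... | yes refl = Adj⇒0<deg step
  ... | no z≢y   = Conn⇒0<deg path z≢y

  Root : List (Edge n) → Pred (Fin n) 0ℓ
  Root F x = ∀ y → y <ᶠ x → ¬ Conn F x y

  Root? : (F : List (Edge n)) → Decidable (Root F)
  Root? F x = all? (λ y → (y <? x) →-dec ¬? (Conn? F x y))

  non-root : {F : List (Edge n)} {x : Fin n} → ¬ Root F x → ∃ λ y → y <ᶠ x × Conn F x y
  non-root {F = F} {x} ¬root =
    decidable-stable (any? (λ y → (y <? x) ×-dec Conn? F x y)) (λ none → ¬root (λ y y<x x~y → none (y , y<x , x~y)))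

  lost-roots-ordered : {F : List (Edge n)} {a b x x′ : Fin n} → x <ᶠ x′ →
    Root F x → ¬ Root ((a , b) ∷ F) x → Root F x′ → ¬ Root ((a , b) ∷ F) x′ → ⊥
  lost-roots-ordered x<x′ root ¬root root′ ¬root′
    with non-root ¬root | non-root ¬root′
  ... | y , y<x , x~y | y′ , y′<x′ , x′~y′ with Conn-∷⁻ x~y | Conn-∷⁻ x′~y′
  ... | inj₁ x~y | _ = root _ y<x x~y
  ... | inj₂ _ | inj₁ x′~y′ = root′ _ y′<x′ x′~y′
  ... | inj₂ (inj₁ (x~a , _))   | inj₂ (inj₁ (x′~a , _)) = root′ _ x<x′ (x′~a ◅◅ Conn-sym x~a)
  ... | inj₂ (inj₁ (_ , b~y))   | inj₂ (inj₂ (x′~b , _)) = root′ _ (<ᶠ-trans y<x x<x′) (x′~b ◅◅ b~y)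
  ... | inj₂ (inj₂ (_ , a~y))   | inj₂ (inj₁ (x′~a , _)) = root′ _ (<ᶠ-trans y<x x<x′) (x′~a ◅◅ a~y)
  ... | inj₂ (inj₂ (x~b , _))   | inj₂ (inj₂ (x′~b , _)) = root′ _ x<x′ (x′~b ◅◅ Conn-sym x~b)

  lost-root-unique : {F : List (Edge n)} {f : Edge n} {x x′ : Fin n} →
    Root F x → ¬ Root (f ∷ F) x → Root F x′ → ¬ Root (f ∷ F) x′ → x ≡ x′
  lost-root-unique {x = x} {x′} root ¬root root′ ¬root′ with <-cmp x x′
  ... | tri< x<x′ _ _ = ⊥-elim (lost-roots-ordered x<x′ root ¬root root′ ¬root′)
  ... | tri≈ _ x≡x′ _ = x≡x′
  ... | tri> _ _ x′<x = ⊥-elim (lost-roots-ordered x′<x root′ ¬root′ root ¬root)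

  ≤-roots+edges : (F : List (Edge n)) → n ≤ count (Root? F) + length F
  ≤-roots+edges [] = ≤-reflexive (sym (trans (+-identityʳ _) (count-all (Root? []) all-roots)))
    where
    all-roots : ∀ x → Root [] x
    all-roots x y y<x x~y = <ᶠ-irrefl (sym (Conn-[] x~y)) y<x
  ≤-roots+edges {n} (f ∷ F) = begin
    n                                       ≤⟨ ≤-roots+edges F ⟩
    count (Root? F) + length F              ≤⟨ +-monoˡ-≤ (length F) roots-lost≤1 ⟩
    suc (count (Root? (f ∷ F))) + length F  ≡⟨ +-suc _ _ ⟨
    count (Root? (f ∷ F)) + length (f ∷ F)  ∎
    where
    open ℕ.≤-Reasoning
    roots-lost≤1 : count (Root? F) ≤ suc (count (Root? (f ∷ F)))
    roots-lost≤1 = count-≤-suc (Root? F) (Root? (f ∷ F)) lost-root-unique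

  connected⇒≤suc-length : {F : List (Edge n)} → (∀ x y → Conn F x y) → n ≤ suc (length F)
  connected⇒≤suc-length {n = zero}  _ = z≤n
  connected⇒≤suc-length {n = suc n} {F} connected =
    ≤-trans (≤-roots+edges F) (+-monoˡ-≤ (length F) (count-≤-1 (Root? F) zero zero-only-root))
    where
    zero-only-root : ∀ {x} → Root F x → zero ≡ x
    zero-only-root {zero}  _    = refl
    zero-only-root {suc x} root = contradiction (connected (suc x) zero) (root zero (s≤s z≤n))

  OnWalk⊎Conn : {G F : List (Edge n)} {f : Edge n} {x y : Fin n} →
                G ↭ f ∷ F → (p : Walk G x y) → OnWalk f p ⊎ Conn F x y
  OnWalk⊎Conn G↭ []          = inj₂ ε
  OnWalk⊎Conn G↭ (step ∷ p) with Adj-∷⁻ (Adj-↭ G↭ step) | OnWalk⊎Conn G↭ p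
  ... | inj₁ f≡xy          | _          = inj₁ (inj₁ f≡xy)
  ... | inj₂ (inj₁ f≡yx)   | _          = inj₁ (inj₂ (inj₁ f≡yx))
  ... | inj₂ (inj₂ _)      | inj₁ on-p  = inj₁ (inj₂ (inj₂ on-p))
  ... | inj₂ (inj₂ step′)  | inj₂ y~z   = inj₂ (step′ ◅ y~z)

  tree-edge-bridge : {G F : List (Edge n)} {a b : Fin n} → IsTree G → G ↭ (a , b) ∷ F → ¬ Conn F a b
  tree-edge-bridge {n} {G} {F} (connected , size) G↭ a~b =
    1+n≰n (subst (_≤ suc (length F)) n≡2+|F| (connected⇒≤suc-length F-connected))
    where
    n≡2+|F| : n ≡ suc (suc (length F))
    n≡2+|F| = trans (sym size) (cong suc (↭-length G↭))
    edge-in-F : ∀ {x y} → Adj G x y → Conn F x y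
    edge-in-F step with Adj-∷⁻ (Adj-↭ G↭ step)
    ... | inj₁ refl          = a~b
    ... | inj₂ (inj₁ refl)   = Conn-sym a~b
    ... | inj₂ (inj₂ step′)  = step′ ◅ ε
    F-connected : ∀ x y → Conn F x y
    F-connected x y = (edge-in-F ⋆) (connected x y)

  deg-∷ : (f : Edge n) (F : List (Edge n)) (x : Fin n) → deg (f ∷ F) x ≡ 𝟙 (incident? x f) + deg F x
  deg-∷ f F x = length-filter-∷ (incident? x) f F

  deg-++ : (F G : List (Edge n)) (x : Fin n) → deg (F ++ G) x ≡ deg F x + deg G x
  deg-++ F G x = trans (cong length (filter-++ (incident? x) F G)) (length-++ (filter (incident? x) F))

  deg-↭ : {F G : List (Edge n)} → F ↭ G → (x : Fin n) → deg F x ≡ deg G x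
  deg-↭ F↭G x = ↭-length (filter-↭ (incident? x) F↭G)

  module DegreeSum {S : Pred (Fin n) p} (S? : Decidable S) where

    ∑ˢ : (Fin n → ℕ) → ℕ
    ∑ˢ f = ∑[ x < n ] (f x * 𝟙 (S? x))

    ∑ˢ-+ : {f : Fin n → ℕ} (g h : Fin n → ℕ) → (∀ x → f x ≡ g x + h x) → ∑ˢ f ≡ ∑ˢ g + ∑ˢ h
    ∑ˢ-+ {f} g h f≡g+h = trans (sum-cong-≗ split) (∑-distrib-+ (λ x → g x * 𝟙 (S? x)) (λ x → h x * 𝟙 (S? x)))
      where
      split : ∀ x → f x * 𝟙 (S? x) ≡ g x * 𝟙 (S? x) + h x * 𝟙 (S? x)
      split x = trans (cong (_* 𝟙 (S? x)) (f≡g+h x)) (*-distribʳ-+ (𝟙 (S? x)) (g x) (h x))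

    ∑deg : List (Edge n) → ℕ
    ∑deg F = ∑ˢ (deg F)

    ends : Edge n → ℕ
    ends f = ∑ˢ (λ x → 𝟙 (incident? x f))

    ∑deg-∷ : ∀ f F → ∑deg (f ∷ F) ≡ ends f + ∑deg F
    ∑deg-∷ f F = ∑ˢ-+ (λ x → 𝟙 (incident? x f)) (deg F) (deg-∷ f F)

    ∑deg-++ : ∀ F G → ∑deg (F ++ G) ≡ ∑deg F + ∑deg G
    ∑deg-++ F G = ∑ˢ-+ (deg F) (deg G) (deg-++ F G)

    ∑deg-↭ : ∀ {F G} → F ↭ G → ∑deg F ≡ ∑deg G
    ∑deg-↭ F↭G = sum-cong-≗ (λ x → cong (_* 𝟙 (S? x)) (deg-↭ F↭G x))

    ends≤ : ∀ a b → ends (a , b) ≤ 𝟙 (S? a) + 𝟙 (S? b)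
    ends≤ a b = begin
      ends (a , b)
        ≤⟨ ∑-mono-≤ endpoint ⟩
      ∑[ x < n ] (𝟙 (a ≟ x) * 𝟙 (S? a) + 𝟙 (b ≟ x) * 𝟙 (S? b))
        ≡⟨ ∑-distrib-+ (λ x → 𝟙 (a ≟ x) * 𝟙 (S? a)) (λ x → 𝟙 (b ≟ x) * 𝟙 (S? b)) ⟩
      ∑[ x < n ] (𝟙 (a ≟ x) * 𝟙 (S? a)) + ∑[ x < n ] (𝟙 (b ≟ x) * 𝟙 (S? b))
        ≡⟨ cong₂ _+_ (∑-δ a _) (∑-δ b _) ⟩
      𝟙 (S? a) + 𝟙 (S? b)
        ∎
      where
      open ℕ.≤-Reasoning
      endpoint : ∀ x → 𝟙 ((a ≟ x) ⊎-dec (b ≟ x)) * 𝟙 (S? x) ≤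
                       𝟙 (a ≟ x) * 𝟙 (S? a) + 𝟙 (b ≟ x) * 𝟙 (S? b)
      endpoint x with a ≟ x | b ≟ x
      ... | yes refl | _        = m≤m+n _ _
      ... | no _     | yes refl = ≤-refl
      ... | no _     | no _     = z≤n

    ends≤2 : ∀ f → ends f ≤ 2
    ends≤2 (a , b) = ≤-trans (ends≤ a b) (+-mono-≤ (𝟙≤1 (S? a)) (𝟙≤1 (S? b)))

    ∑deg≤2*length : ∀ F → ∑deg F ≤ 2 * length F
    ∑deg≤2*length []      = ≤-reflexive (sum-replicate-zero n)
    ∑deg≤2*length (f ∷ F) = begin
      ∑deg (f ∷ F)             ≡⟨ ∑deg-∷ f F ⟩
      ends f + ∑deg F          ≤⟨ +-mono-≤ (ends≤2 f) (∑deg≤2*length F) ⟩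
      2 + 2 * length F         ≡⟨ *-suc 2 (length F) ⟨
      2 * length (f ∷ F)       ∎
      where open ℕ.≤-Reasoning

    ∑deg-outside : ∀ {F} → All (λ f → ¬ S (proj₁ f) × ¬ S (proj₂ f)) F → ∑deg F ≡ 0
    ∑deg-outside []                                  = sum-replicate-zero n
    ∑deg-outside {(a , b) ∷ F} ((¬Sa , ¬Sb) ∷ outside) = begin
      ∑deg ((a , b) ∷ F)         ≡⟨ ∑deg-∷ (a , b) F ⟩
      ends (a , b) + ∑deg F      ≡⟨ cong₂ _+_ (n≤0⇒n≡0 ends≤0) (∑deg-outside outside) ⟩
      0                          ∎
      where
      open ≡-Reasoning
      ends≤0 : ends (a , b) ≤ 0
      ends≤0 = ≤-trans (ends≤ a b) (≤-reflexive (cong₂ _+_ (𝟙-no (S? a) ¬Sa) (𝟙-no (S? b) ¬Sb)))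

  -- Tᵥ is the paper's T_v, the component of v once e is deleted; Eᵢ and Eₒ are the
  -- remaining edges inside and outside it.
  module Component {es rest Eᵢ Eₒ : List (Edge n)} {e : Edge n} {v : Fin n}
    (tree : IsTree es) (es↭ : es ↭ e ∷ rest) (rest↭ : rest ↭ Eᵢ ++ Eₒ)
    (inner : All (λ f → Conn rest v (proj₁ f) × Conn rest v (proj₂ f)) Eᵢ)
    (outer : All (λ f → ¬ Conn rest v (proj₁ f) × ¬ Conn rest v (proj₂ f)) Eₒ) where

    Tᵥ? : Decidable (Conn rest v)
    Tᵥ? = Conn? rest v

    Tᵥ⁻? : Decidable (λ x → Conn rest v x × v ≢ x)
    Tᵥ⁻? x = Tᵥ? x ×-dec ¬? (v ≟ x)

    open DegreeSum Tᵥ?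

    e-leaves-Tᵥ : ¬ (Conn rest v (proj₁ e) × Conn rest v (proj₂ e))
    e-leaves-Tᵥ (v~a , v~b) = tree-edge-bridge tree es↭ (Conn-sym v~a ◅◅ v~b)

    -- Eₒ, e and a star from v onto Tᵥ span the whole tree, so they have at least n - 1 edges.
    |Eᵢ|≤|Tᵥ⁻| : length Eᵢ ≤ count Tᵥ⁻?
    |Eᵢ|≤|Tᵥ⁻| = +-cancelʳ-≤ (length Eₒ) _ _ (+-cancelˡ-≤ 2 _ _ (begin
      2 + (length Eᵢ + length Eₒ)     ≡⟨ cong suc length-es ⟨
      suc (length es)                 ≡⟨ proj₂ tree ⟩
      n                               ≤⟨ connected⇒≤suc-length H-connected ⟩
      suc (length H)                  ≡⟨ cong (2 +_) (trans (length-++ star) (cong (_+ length Eₒ) length-star)) ⟩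
      2 + (count Tᵥ⁻? + length Eₒ)    ∎))
      where
      open ℕ.≤-Reasoning
      star : List (Edge n)
      star = map (v ,_) (filter Tᵥ⁻? (allFin n))
      H : List (Edge n)
      H = e ∷ star ++ Eₒ
      length-es : length es ≡ suc (length Eᵢ + length Eₒ)
      length-es = trans (↭-length es↭) (cong suc (trans (↭-length rest↭) (length-++ Eᵢ)))
      length-star : length star ≡ count Tᵥ⁻?
      length-star = trans (length-map (v ,_) (filter Tᵥ⁻? (allFin n))) (length-filter-tabulate Tᵥ⁻? id)
      v~ₕ : ∀ {x} → Conn rest v x → Conn H v x
      v~ₕ {x} v~x with v ≟ x
      ... | yes refl = ε
      ... | no v≢x   = inj₁ (there (∈-++⁺ˡ star-edge)) ◅ ε
        where
        star-edge : (v , x) ∈ star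
        star-edge = ∈-map⁺ (v ,_) (∈-filter⁺ Tᵥ⁻? (∈-allFin x) (v~x , v≢x))
      rest-edge : ∀ {f} → f ∈ rest → Conn H (proj₁ f) (proj₂ f)
      rest-edge f∈rest with ∈-++⁻ Eᵢ (∈-resp-↭ rest↭ f∈rest)
      ... | inj₁ f∈Eᵢ = let v~a , v~b = All.lookup inner f∈Eᵢ in Conn-sym (v~ₕ v~a) ◅◅ v~ₕ v~b
      ... | inj₂ f∈Eₒ = inj₁ (there (∈-++⁺ʳ star f∈Eₒ)) ◅ ε
      edge-in-H : ∀ {x y} → Adj es x y → Conn H x y
      edge-in-H step with Adj-∷⁻ (Adj-↭ es↭ step)
      ... | inj₁ e≡xy                  = inj₁ (here (sym e≡xy)) ◅ ε
      ... | inj₂ (inj₁ e≡yx)           = inj₂ (here (sym e≡yx)) ◅ ε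
      ... | inj₂ (inj₂ (inj₁ xy∈rest)) = rest-edge xy∈rest
      ... | inj₂ (inj₂ (inj₂ yx∈rest)) = Conn-sym (rest-edge yx∈rest)
      H-connected : ∀ x y → Conn H x y
      H-connected x y = (edge-in-H ⋆) (proj₁ tree x y)

    ∑deg-upper : ∑deg es ≤ 1 + 2 * length Eᵢ
    ∑deg-upper = begin
      ∑deg es                       ≡⟨ ∑deg-↭ (↭-trans es↭ (↭-prep e rest↭)) ⟩
      ∑deg (e ∷ Eᵢ ++ Eₒ)           ≡⟨ ∑deg-∷ e (Eᵢ ++ Eₒ) ⟩
      ends e + ∑deg (Eᵢ ++ Eₒ)      ≡⟨ cong (ends e +_) (∑deg-++ Eᵢ Eₒ) ⟩
      ends e + (∑deg Eᵢ + ∑deg Eₒ)  ≤⟨ +-mono-≤ ends-e≤1 (+-monoˡ-≤ (∑deg Eₒ) (∑deg≤2*length Eᵢ)) ⟩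
      1 + (2 * length Eᵢ + ∑deg Eₒ) ≡⟨ cong (λ m → 1 + (2 * length Eᵢ + m)) (∑deg-outside outer) ⟩
      1 + (2 * length Eᵢ + 0)       ≡⟨ cong suc (+-identityʳ _) ⟩
      1 + 2 * length Eᵢ             ∎
      where
      open ℕ.≤-Reasoning
      ends-e≤1 : ends e ≤ 1
      ends-e≤1 = ≤-trans (ends≤ (proj₁ e) (proj₂ e)) (𝟙+𝟙≤1 e-leaves-Tᵥ (Tᵥ? _) (Tᵥ? _))

    second-leaf : IsLeaf es v → ∀ {u} → Conn rest v u → 3 ≤ deg es u →
                  ∃ λ x → Conn rest v x × v ≢ x × IsLeaf es x
    second-leaf v-leaf {u} v~u u-branching with any? (λ x → Tᵥ⁻? x ×-dec (deg es x ℕ.≟ 1))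
    ... | yes (x , (v~x , v≢x) , x-leaf) = x , v~x , v≢x , x-leaf
    ... | no no-leaf = ⊥-elim (1+n≰n (begin
      2 + 2 * count Tᵥ⁻?  ≤⟨ ∑deg-lower ⟩
      ∑deg es             ≤⟨ ∑deg-upper ⟩
      1 + 2 * length Eᵢ   ≤⟨ +-monoʳ-≤ 1 (*-monoʳ-≤ 2 |Eᵢ|≤|Tᵥ⁻|) ⟩
      1 + 2 * count Tᵥ⁻?  ∎))
      where
      open ℕ.≤-Reasoning
      v≢u : v ≢ u
      v≢u v≡u with ≤-trans (subst (λ y → 3 ≤ deg es y) (sym v≡u) u-branching) (≤-reflexive v-leaf)
      ... | s≤s ()
      inner-deg≥2 : ∀ {x} → Conn rest v x → v ≢ x → 2 ≤ deg es x
      inner-deg≥2 {x} v~x v≢x =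
        ≤∧≢⇒< (Conn⇒0<deg (Conn-⊆ rest⊆es v~x) v≢x) (λ 1≡deg → no-leaf (x , (v~x , v≢x) , sym 1≡deg))
        where
        rest⊆es : rest ⊆ˡ es
        rest⊆es = ∈-resp-↭ (↭-sym es↭) ∘ there
      -- v contributes deg v = 1, u at least 3 and every other vertex of Tᵥ at least 2.
      degree-lower : ∀ x → 𝟙 (v ≟ x) + (𝟙 (u ≟ x) + 2 * 𝟙 (Tᵥ? x ×-dec ¬? (v ≟ x))) ≤
                           deg es x * 𝟙 (Tᵥ? x)
      degree-lower x with v ≟ x | u ≟ x | Tᵥ? x
      ... | yes refl | yes u≡v  | _       = contradiction (sym u≡v) v≢u
      ... | yes refl | no _     | yes _   = ≤-trans (≤-reflexive (sym v-leaf)) (m≤m*n _ 1)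
      ... | yes refl | no _     | no v∉Tᵥ = contradiction ε v∉Tᵥ
      ... | no _     | yes refl | yes _   = ≤-trans u-branching (m≤m*n _ 1)
      ... | no _     | yes refl | no u∉Tᵥ = contradiction v~u u∉Tᵥ
      ... | no v≢x   | no _     | yes v~x = ≤-trans (inner-deg≥2 v~x v≢x) (m≤m*n _ 1)
      ... | no _     | no _     | no _    = z≤n
      ∑deg-lower : 2 + 2 * count Tᵥ⁻? ≤ ∑deg es
      ∑deg-lower = begin
        2 + 2 * count Tᵥ⁻?
          ≡⟨ cong₂ _+_ (∑-𝟙-≟ v) (cong₂ _+_ (∑-𝟙-≟ u) (sym (*-distribˡ-sum 2 (𝟙 ∘ Tᵥ⁻?)))) ⟨
        ∑[ x < n ] 𝟙 (v ≟ x) + (∑[ x < n ] 𝟙 (u ≟ x) + ∑[ x < n ] (2 * 𝟙 (Tᵥ⁻? x)))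
          ≡⟨ trans (∑-distrib-+ (𝟙 ∘ (v ≟_)) (λ x → 𝟙 (u ≟ x) + 2 * 𝟙 (Tᵥ⁻? x)))
                   (cong (∑[ x < n ] 𝟙 (v ≟ x) +_) (∑-distrib-+ (𝟙 ∘ (u ≟_)) (λ x → 2 * 𝟙 (Tᵥ⁻? x)))) ⟨
        ∑[ x < n ] (𝟙 (v ≟ x) + (𝟙 (u ≟ x) + 2 * 𝟙 (Tᵥ⁻? x)))
          ≤⟨ ∑-mono-≤ degree-lower ⟩
        ∑deg es ∎

open Graphs

open import Data.Nat using (ℕ; zero; suc; _≤_; NonZero)
open import Data.Nat.Properties using (_≤?_)
open import Data.Integer using (+_)
open import Data.Rational using (ℚ; 0ℚ; 1ℚ; ½; _+_; _-_; _*_; _/_) renaming (_≤_ to _≤ℚ_; _<_ to _<ℚ_)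
import Data.Rational.Properties as ℚ
open import Data.Rational.Solver using (module +-*-Solver)
open import Data.Bool.Base using (true; false; if_then_else_)
open import Data.Fin.Base using (Fin; zero; suc)
open import Data.Fin.Properties using (any?)
open import Data.Fin.Subset using (Subset) renaming (_∈_ to _∈ˢ_)
import Data.Vec.Base as Vec
open import Data.Vec.Base using (lookup)
open import Data.Vec.Properties using ([]=⇒lookup; lookup⇒[]=; lookup∘tabulate)
open import Data.List.Base using (List)
open import Data.List.Relation.Unary.Any using (here)
open import Data.List.Relation.Binary.Permutation.Propositional using (↭-sym)
open import Data.List.Relation.Binary.Permutation.Propositional.Properties using (∈-resp-↭)
open import Data.Empty using (⊥-elim)
open import Data.Product using (_,_; proj₁; proj₂)
open import Data.Sum using (inj₁; inj₂)
open import Data.Unit using (⊤)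
open import Function.Base using (_∘_)
open import Function.Bundles using (mk⇔)
import Relation.Binary.Construct.Closure.ReflexiveTransitive as Star
open import Relation.Binary.PropositionalEquality using (_≡_; _≢_; refl; sym; trans; cong; subst; subst₂)
open import Relation.Nullary using (¬_; yes; no; does; contradiction)
open import Relation.Nullary.Decidable using (dec-true)

private
  variable
    n : ℕ

p≤q+p : ∀ {p q} → 0ℚ ≤ℚ q → p ≤ℚ q + p
p≤q+p {p} {q} 0≤q = subst (_≤ℚ q + p) (ℚ.+-identityˡ p) (ℚ.+-monoˡ-≤ p 0≤q)

p≤p+q : ∀ {p q} → 0ℚ ≤ℚ q → p ≤ℚ p + q
p≤p+q {p} {q} 0≤q = subst (_≤ℚ p + q) (ℚ.+-identityʳ p) (ℚ.+-monoʳ-≤ p 0≤q)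

sumFin-nonneg : (f : Fin n → ℚ) → (∀ i → 0ℚ ≤ℚ f i) → 0ℚ ≤ℚ sumFin f
sumFin-nonneg {zero}  f f≥0 = ℚ.≤-refl
sumFin-nonneg {suc n} f f≥0 = ℚ.+-mono-≤ (f≥0 zero) (sumFin-nonneg (f ∘ suc) (f≥0 ∘ suc))

sumFin-single : (f : Fin n → ℚ) → (∀ i → 0ℚ ≤ℚ f i) → ∀ a → f a ≤ℚ sumFin f
sumFin-single {suc n} f f≥0 zero    = p≤p+q (sumFin-nonneg (f ∘ suc) (f≥0 ∘ suc))
sumFin-single {suc n} f f≥0 (suc a) = ℚ.≤-trans (sumFin-single (f ∘ suc) (f≥0 ∘ suc) a) (p≤q+p (f≥0 zero))

sumFin-pair : (f : Fin n → ℚ) → (∀ i → 0ℚ ≤ℚ f i) → ∀ {a b} → a ≢ b → f a + f b ≤ℚ sumFin f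
sumFin-pair {suc n} f f≥0 {zero}  {zero}  0≢0 = contradiction refl 0≢0
sumFin-pair {suc n} f f≥0 {zero}  {suc b} _   = ℚ.+-monoʳ-≤ (f zero) (sumFin-single (f ∘ suc) (f≥0 ∘ suc) b)
sumFin-pair {suc n} f f≥0 {suc a} {zero}  _   =
  subst (_≤ℚ sumFin f) (ℚ.+-comm (f zero) (f (suc a))) (ℚ.+-monoʳ-≤ (f zero) (sumFin-single (f ∘ suc) (f≥0 ∘ suc) a))
sumFin-pair {suc n} f f≥0 {suc a} {suc b} a≢b =
  ℚ.≤-trans (sumFin-pair (f ∘ suc) (f≥0 ∘ suc) (a≢b ∘ cong suc)) (p≤q+p (f≥0 zero))

weight-pair : {w : Fin n → ℚ} {C : Subset n} → (∀ i → 0ℚ ≤ℚ w i) →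
              ∀ {x y} → x ∈ˢ C → y ∈ˢ C → x ≢ y → w x + w y ≤ℚ weight w C
weight-pair {w = w} {C} w≥0 x∈C y∈C x≢y =
  subst₂ (λ p q → p + q ≤ℚ weight w C) (masked-∈ x∈C) (masked-∈ y∈C) (sumFin-pair masked masked≥0 x≢y)
  where
  masked : Fin _ → ℚ
  masked i = if lookup C i then w i else 0ℚ
  masked≥0 : ∀ i → 0ℚ ≤ℚ masked i
  masked≥0 i with lookup C i
  ... | true  = w≥0 i
  ... | false = ℚ.≤-refl
  masked-∈ : ∀ {i} → i ∈ˢ C → masked i ≡ w i
  masked-∈ i∈C rewrite []=⇒lookup i∈C = refl

district+district≰district : (k : ℕ) .{{_ : NonZero k}} {ε x y z : ℚ} → ε <ℚ (+ 2 / 3) * (+ 1 / k) →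
                     District k ε x → District k ε y → District k ε z → ¬ (x + y ≤ℚ z)
district+district≰district k {ε} ε<⅔/k (a-h≤x , _) (a-h≤y , _) (_ , z≤a+h) x+y≤z = ℚ.<-irrefl refl (begin-strict
  (a + h) + a              ≡⟨ rearrange a ε ⟩
  ((a - h) + (a - h)) + t  ≤⟨ ℚ.+-monoˡ-≤ t (ℚ.≤-trans (ℚ.+-mono-≤ a-h≤x a-h≤y) (ℚ.≤-trans x+y≤z z≤a+h)) ⟩
  (a + h) + t              <⟨ ℚ.+-monoʳ-< (a + h) t<a ⟩
  (a + h) + a              ∎)
  where
  open ℚ.≤-Reasoning
  open +-*-Solver
  a h t : ℚ
  a = + 1 / k
  h = ε * ½
  t = (+ 3 / 2) * ε
  rearrange : ∀ a ε → (a + ε * ½) + a ≡ ((a - ε * ½) + (a - ε * ½)) + (+ 3 / 2) * ε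
  rearrange = solve 2 (λ a ε → (a :+ ε :* con ½) :+ a := ((a :- ε :* con ½) :+ (a :- ε :* con ½)) :+ con (+ 3 / 2) :* ε) refl
  cancel : ∀ a → (+ 3 / 2) * ((+ 2 / 3) * a) ≡ a
  cancel = solve 1 (λ a → con (+ 3 / 2) :* (con (+ 2 / 3) :* a) := a) refl
  t<a : t <ℚ a
  t<a = subst (t <ℚ_) (cancel a) (ℚ.*-monoʳ-<-pos (+ 3 / 2) ε<⅔/k)

component : List (Edge n) → Fin n → Subset n
component F x = Vec.tabulate (λ y → does (Conn? F x y))

∈-component : {F : List (Edge n)} {x y : Fin n} → Conn F x y → y ∈ˢ component F x
∈-component {F = F} {x} {y} x~y =
  lookup⇒[]= y _ (trans (lookup∘tabulate _ y) (dec-true (Conn? F x y) x~y))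

component-isComponent : (F : List (Edge n)) (x : Fin n) → IsComponent F x (component F x)
component-isComponent F x y = mk⇔ (to y) ∈-component
  where
  to : ∀ y → y ∈ˢ component F x → Conn F x y
  to y y∈ with Conn? F x y | trans (sym (lookup∘tabulate _ y)) ([]=⇒lookup y∈)
  ... | yes x~y | _  = x~y
  ... | no _    | ()

lemma6p5 : (k : ℕ) .{{_ : NonZero k}} (ε : ℚ) (ℓ n : ℕ) (es : List (Edge n)) (w : Fin n → ℚ) →
  2 ≤ k → 0ℚ <ℚ ε → ε <ℚ (+ 2 / 3) * (+ 1 / k) →
  IsTree es → (∀ v → 0ℚ ≤ℚ w v) → sumFin w ≡ 1ℚ →
  Splittable k ε w ℓ (λ _ → ⊤) es →
  (∀ v → IsLeaf es v → District k ε (w v)) →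
  ∀ v → IsLeaf es v → ∀ e → Viable k ε w ℓ es v e → InBranch es v e
lemma6p5 k _ ℓ n es w _ _ ε<⅔/k tree w≥0 _ _ leaf-district v v-leaf e
         (rest , es↭ , Eᵢ , Eₒ , rest↭ , inner , outer , Tᵥ-district , _)
  with any? (λ u → 3 ≤? deg es u)
... | no  max-deg<3 = inj₁ (max-deg<3 , ∈-resp-↭ (↭-sym es↭) (here refl))
... | yes max-deg≥3 = inj₂ (max-deg≥3 , λ u p nearest → e-on-walk p (proj₁ (proj₂ nearest)))
  where
  open Component tree es↭ rest↭ inner outer
  e-on-walk : ∀ {u} (p : Walk es v u) → 3 ≤ deg es u → OnWalk e p
  e-on-walk p u-branching with OnWalk⊎Conn es↭ p
  ... | inj₁ e-on-p = e-on-p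
  ... | inj₂ v~u with second-leaf v-leaf v~u u-branching
  ... | v′ , v~v′ , v≢v′ , v′-leaf =
    ⊥-elim (district+district≰district k ε<⅔/k (leaf-district v v-leaf) (leaf-district v′ v′-leaf)
              (Tᵥ-district _ (component-isComponent rest v))
              (weight-pair w≥0 (∈-component {F = rest} Star.ε) (∈-component v~v′) v≢v′))
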